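{- A pre-Galois word $T$ has at most two Galois roots, and if it has two, their lengths have different parities.
   Context: An integer $p\in[1..|W|]$ is a period of $W$ if $W[i+p]=W[i]$ for all $i\in[1..|W|-p]$. Alternating order: for words $S,T$ with $S^\omega\neq T^\omega$ ($X^\omega$ the infinite repetition of $X$), let $j$ be the first position with $S^\omega[j]\neq T^\omega[j]$; $S\prec_{\mathrm{alt}}T$ if $j$ is odd and $S^\omega[j]<T^\omega[j]$, or $j$ is even and $S^\omega[j]>T^\omega[j]$. $S=_{\mathrm{alt}}T$ if $S^\omega=T^\omega$; $\varepsilon\succ_{\mathrm{alt}}X$ for every nonempty $X$. A word is Galois if it is strictly smaller with respect to $\prec_{\mathrm{alt}}$ than all its other cyclic rotations. A word $T$ is pre-Galois if every proper suffix $S$ of $T$ is a prefix of $T$ or satisfies $S\succ_{\mathrm{alt}}T$. A Galois root of a pre-Galois word $T$ is a prefix $P$ of $T$ such that $|P|$ is a period of $T$ and $P$ is Galois. -}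

module Defs where

open import Data.Nat using (ℕ; zero; suc; _+_; _<_; _>_; _≤_)
open import Data.Nat.DivMod using (_%_; m%n<n)
open import Data.Fin using (fromℕ<)
open import Data.List using (List; []; _∷_; length; lookup; take; drop; _++_)
open import Data.Product using (Σ; _×_; ∃)
open import Data.Sum using (_⊎_)
open import Data.Empty using (⊥)
open import Data.Unit using (⊤)
open import Relation.Binary.PropositionalEquality using (_≡_)

Word : Set
Word = List ℕ

-- W^ω as a function of 0-based positions (only meaningful for nonempty W).
ω : Word → ℕ → ℕ
ω []       i = 0
ω (x ∷ xs) i = lookup (x ∷ xs) (fromℕ< (m%n<n i (suc (length xs))))

-- 0-based index i corresponds to 1-based position i+1;
-- so 1-based position odd  ⇔  i % 2 ≡ 0.
-- Strict alternating order on nonempty words (first difference of S^ω,T^ω).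
_≺ne_ : Word → Word → Set
S ≺ne T = Σ ℕ λ i → (∀ k → k < i → ω S k ≡ ω T k) ×
  ((i % 2 ≡ 0 × ω S i < ω T i) ⊎ (i % 2 ≡ 1 × ω S i > ω T i))

_≺alt_ : Word → Word → Set
[]      ≺alt T       = ⊥
(x ∷ S) ≺alt []      = ⊤
(x ∷ S) ≺alt (y ∷ T) = (x ∷ S) ≺ne (y ∷ T)

IsPeriod : ℕ → Word → Set
IsPeriod p W = 1 ≤ p × p ≤ length W ×
  (∀ i → i + p < length W → ω W (i + p) ≡ ω W i)

IsPrefix : Word → Word → Set
IsPrefix P T = ∃ λ U → P ++ U ≡ T

rot : ℕ → Word → Word
rot k W = drop k W ++ take k W

IsGalois : Word → Set
IsGalois W = ∀ k → 0 < k → k < length W → W ≺alt rot k W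

IsPreGalois : Word → Set
IsPreGalois T = ∀ k → 1 ≤ k → k ≤ length T →
  IsPrefix (drop k T) T ⊎ T ≺alt drop k T

IsGaloisRoot : Word → Word → Set
IsGaloisRoot P T = IsPrefix P T × IsPeriod (length P) T × IsGalois P

{-# OPTIONS --safe #-}
module Submission where

-- Let Q be a Galois root of T and p < |Q| the length of another one, with p ≡ |Q| (mod 2), and put
-- d = |Q| − p, an even number. Write f = Q^ω and σ for the shift. The periods p of T and |Q| of f make
-- σᵖ f = u f, where u is the prefix of f of length d, while trivially f = u σᵈ f. Prepending a word of
-- even length preserves the alternating order, so f ≺ σᵖ f (Q is Galois) gives σᵈ f ≺ f, contradicting
-- f ≺ σᵈ f (Q is Galois again).
-- Three distinct roots would need three pairwise distinct parities.

open import Defs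
open import Data.Nat using (ℕ; zero; suc; _+_; _*_; _%_; _/_; _<_; _>_; _≤_; _≟_; _<?_; NonZero; s≤s; s≤s⁻¹)
open import Data.Nat.Properties
open import Data.Nat.DivMod
  using (%-distribˡ-+; %-remove-+ˡ; m%n<n; [m+n]%n≡m%n; [m+kn]%n≡m%n; m≡m%n+[m/n]*n; m<n⇒m%n≡m)
open import Data.Nat.Divisibility using (_∣_; m%n≡0⇒n∣m)
open import Data.Fin using (fromℕ<)
open import Data.List using ([]; _∷_; length; lookup; take; drop; _++_)
open import Data.List.Properties
  using ( length-++; length-++-comm; length-++-≤ˡ; length-take; ++-identityʳ; take++drop≡id
        ; ≡-dec; ∷-injectiveˡ; ∷-injectiveʳ)
open import Data.Product using (Σ; _×_; _,_)
open import Data.Sum using (_⊎_; inj₁; inj₂)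
open import Function using (_∘_)
open import Relation.Nullary using (¬_; yes; no; contradiction)
open import Relation.Nullary.Decidable using (decidable-stable)
open import Relation.Binary.Definitions using (DecidableEquality; tri<; tri≈; tri>)
open import Relation.Binary.PropositionalEquality
  using (_≡_; _≢_; refl; sym; trans; cong; cong₂; subst; subst₂; _≗_; module ≡-Reasoning)

[m+n%d]%d≡[m+n]%d : ∀ m n d .{{_ : NonZero d}} → (m + n % d) % d ≡ (m + n) % d
[m+n%d]%d≡[m+n]%d m n d = begin
  (m + n % d) % d               ≡⟨ [m+kn]%n≡m%n (m + n % d) (n / d) d ⟨
  (m + n % d + n / d * d) % d   ≡⟨ cong (_% d) (+-assoc m (n % d) (n / d * d)) ⟩
  (m + (n % d + n / d * d)) % d ≡⟨ cong (λ k → (m + k) % d) (m≡m%n+[m/n]*n n d) ⟨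
  (m + n) % d                   ∎
  where open ≡-Reasoning

m%2≡[m+n]%2⇒2∣n : ∀ m n → m % 2 ≡ (m + n) % 2 → 2 ∣ n
m%2≡[m+n]%2⇒2∣n m n eq = m%n≡0⇒n∣m n 2 (bits (m%n<n m 2) (m%n<n n 2) (trans eq (%-distribˡ-+ m n 2)))
  where
  bits : ∀ {x y} → x < 2 → y < 2 → x ≡ (x + y) % 2 → y ≡ 0
  bits {y = 0} _ _ _ = refl
  bits {0} {1} _ _ ()
  bits {1} {1} _ _ ()
  bits {suc (suc _)} (s≤s (s≤s ())) _ _
  bits {y = suc (suc _)} _ (s≤s (s≤s ())) _

%2-pigeonhole : ∀ a b c → a % 2 ≢ b % 2 → a % 2 ≢ c % 2 → b % 2 ≡ c % 2
%2-pigeonhole a b c = bits (m%n<n a 2) (m%n<n b 2) (m%n<n c 2)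
  where
  bits : ∀ {x y z} → x < 2 → y < 2 → z < 2 → x ≢ y → x ≢ z → y ≡ z
  bits {0} {0} _ _ _ x≢y _ = contradiction refl x≢y
  bits {1} {1} _ _ _ x≢y _ = contradiction refl x≢y
  bits {0} {1} {0} _ _ _ _ x≢z = contradiction refl x≢z
  bits {1} {0} {1} _ _ _ _ x≢z = contradiction refl x≢z
  bits {0} {1} {1} _ _ _ _ _ = refl
  bits {1} {0} {0} _ _ _ _ _ = refl
  bits {suc (suc _)} (s≤s (s≤s ())) _ _ _ _
  bits {y = suc (suc _)} _ (s≤s (s≤s ())) _ _ _
  bits {z = suc (suc _)} _ _ (s≤s (s≤s ())) _ _

AltLess : ℕ → ℕ → ℕ → Set
AltLess i a b = (i % 2 ≡ 0 × a < b) ⊎ (i % 2 ≡ 1 × a > b)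

-- The alternating order on infinite words: S ≺ne T of Defs is definitionally ω S ≺ ω T.
infix 4 _≺_

_≺_ : (ℕ → ℕ) → (ℕ → ℕ) → Set
f ≺ g = Σ ℕ λ i → (∀ k → k < i → f k ≡ g k) × AltLess i (f i) (g i)

AltLess⇒≢ : ∀ i {a b} → AltLess i a b → a ≢ b
AltLess⇒≢ _ (inj₁ (_ , a<b)) refl = <-irrefl refl a<b
AltLess⇒≢ _ (inj₂ (_ , a>b)) refl = <-irrefl refl a>b

AltLess-asym : ∀ i {a b} → AltLess i a b → ¬ AltLess i b a
AltLess-asym _ (inj₁ (_ , a<b)) (inj₁ (_ , b<a)) = <-asym a<b b<a
AltLess-asym _ (inj₁ (even , _)) (inj₂ (odd , _)) = 0≢1+n (trans (sym even) odd)
AltLess-asym _ (inj₂ (odd , _)) (inj₁ (even , _)) = 0≢1+n (trans (sym even) odd)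
AltLess-asym _ (inj₂ (_ , a>b)) (inj₂ (_ , b>a)) = <-asym a>b b>a

AltLess-parity : ∀ i j {a b} → i % 2 ≡ j % 2 → AltLess i a b → AltLess j a b
AltLess-parity _ _ i≡j (inj₁ (even , a<b)) = inj₁ (trans (sym i≡j) even , a<b)
AltLess-parity _ _ i≡j (inj₂ (odd , a>b)) = inj₂ (trans (sym i≡j) odd , a>b)

≺-respʳ-≗ : ∀ {f g h} → g ≗ h → f ≺ g → f ≺ h
≺-respʳ-≗ {f} g≗h (i , agree , less) =
  i , (λ k k<i → trans (agree k k<i) (g≗h k)) , subst (AltLess i (f i)) (g≗h i) less

≺-asym : ∀ {f g} → f ≺ g → ¬ (g ≺ f)
≺-asym (i , agreeᶠ , lessᶠ) (j , agreeᵍ , lessᵍ) with <-cmp i j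
... | tri< i<j _ _ = AltLess⇒≢ i lessᶠ (sym (agreeᵍ i i<j))
... | tri≈ _ refl _ = AltLess-asym i lessᶠ lessᵍ
... | tri> _ _ j<i = AltLess⇒≢ j lessᵍ (sym (agreeᶠ j j<i))

≺-drop-even : ∀ {f g d} → 2 ∣ d → (∀ k → k < d → f k ≡ g k) →
  f ≺ g → f ∘ (d +_) ≺ g ∘ (d +_)
≺-drop-even {d = d} 2∣d prefix (i , agree , less) with i <? d
... | yes i<d = contradiction (prefix i i<d) (AltLess⇒≢ i less)
... | no i≮d with m≤n⇒∃[o]m+o≡n (≮⇒≥ i≮d)
...   | m , refl =
  m , (λ k k<m → agree (d + k) (+-monoʳ-< d k<m)) , AltLess-parity (d + m) m (%-remove-+ˡ m 2∣d) less

≺-shift-even-period : ∀ {f p d} → 2 ∣ d → f ∘ ((p + d) +_) ≗ f →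
  (∀ k → k < d → f (p + k) ≡ f k) → f ≺ f ∘ (p +_) → ¬ (f ≺ f ∘ (d +_))
≺-shift-even-period {f} {p} {d} 2∣d period prefix f≺σᵖf f≺σᵈf =
  ≺-asym f≺σᵈf (≺-respʳ-≗ σᵈσᵖf≗f (≺-drop-even 2∣d (λ k k<d → sym (prefix k k<d)) f≺σᵖf))
  where
  σᵈσᵖf≗f : (λ i → f (p + (d + i))) ≗ f
  σᵈσᵖf≗f i = trans (cong f (sym (+-assoc p d i))) (period i)

letter : Word → ℕ → ℕ
letter []       _       = 0
letter (x ∷ xs) zero    = x
letter (x ∷ xs) (suc i) = letter xs i

letter-++ˡ : ∀ A B {i} → i < length A → letter (A ++ B) i ≡ letter A i
letter-++ˡ (x ∷ A) B {zero}  _   = refl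
letter-++ˡ (x ∷ A) B {suc i} i<A = letter-++ˡ A B (s≤s⁻¹ i<A)

letter-++ʳ : ∀ A B i → letter (A ++ B) (length A + i) ≡ letter B i
letter-++ʳ []      B i = refl
letter-++ʳ (x ∷ A) B i = letter-++ʳ A B i

lookup-fromℕ< : ∀ W {i} .(i<W : i < length W) → lookup W (fromℕ< i<W) ≡ letter W i
lookup-fromℕ< (x ∷ W) {zero}  _   = refl
lookup-fromℕ< (x ∷ W) {suc i} i<W = lookup-fromℕ< W (s≤s⁻¹ i<W)

ω≡letter-% : ∀ W {n} .{{_ : NonZero n}} → length W ≡ n → ∀ i → ω W i ≡ letter W (i % n)
ω≡letter-% []       _    i = refl
ω≡letter-% (x ∷ xs) refl i = lookup-fromℕ< (x ∷ xs) (m%n<n i (suc (length xs)))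

ω-cong-% : ∀ W {n} .{{_ : NonZero n}} → length W ≡ n → ∀ i j → i % n ≡ j % n → ω W i ≡ ω W j
ω-cong-% W W≡n i j i≡j =
  trans (ω≡letter-% W W≡n i) (trans (cong (letter W) i≡j) (sym (ω≡letter-% W W≡n j)))

ω≡letter : ∀ W {i} → i < length W → ω W i ≡ letter W i
ω≡letter []       ()
ω≡letter (x ∷ xs) {i} i<W = trans (ω≡letter-% (x ∷ xs) refl i) (cong (letter (x ∷ xs)) (m<n⇒m%n≡m i<W))

ω-periodic : ∀ W i → ω W (length W + i) ≡ ω W i
ω-periodic []       i = refl
ω-periodic W@(_ ∷ _) i =
  ω-cong-% W refl (length W + i) i (trans (cong (_% length W) (+-comm (length W) i)) ([m+n]%n≡m%n i (length W)))

letter-swap : ∀ A B {j} → j < length (B ++ A) → letter (B ++ A) j ≡ ω (A ++ B) (length A + j)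
letter-swap A B {j} j<BA with j <? length B
... | yes j<B = begin
  letter (B ++ A) j              ≡⟨ letter-++ˡ B A j<B ⟩
  letter B j                     ≡⟨ letter-++ʳ A B j ⟨
  letter (A ++ B) (length A + j) ≡⟨ ω≡letter (A ++ B) A+j<AB ⟨
  ω (A ++ B) (length A + j)      ∎
  where
  open ≡-Reasoning
  A+j<AB : length A + j < length (A ++ B)
  A+j<AB = subst (length A + j <_) (sym (length-++ A)) (+-monoʳ-< (length A) j<B)
... | no j≮B with m≤n⇒∃[o]m+o≡n (≮⇒≥ j≮B)
...   | t , refl = begin
  letter (B ++ A) (length B + t)         ≡⟨ letter-++ʳ B A t ⟩
  letter A t                             ≡⟨ letter-++ˡ A B t<A ⟨
  letter (A ++ B) t                      ≡⟨ ω≡letter (A ++ B) t<AB ⟨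
  ω (A ++ B) t                           ≡⟨ ω-periodic (A ++ B) t ⟨
  ω (A ++ B) (length (A ++ B) + t)       ≡⟨ cong (λ m → ω (A ++ B) (m + t)) (length-++ A) ⟩
  ω (A ++ B) (length A + length B + t)   ≡⟨ cong (ω (A ++ B)) (+-assoc (length A) (length B) t) ⟩
  ω (A ++ B) (length A + (length B + t)) ∎
  where
  open ≡-Reasoning
  t<A : t < length A
  t<A = +-cancelˡ-< (length B) t (length A) (subst (length B + t <_) (length-++ B) j<BA)
  t<AB : t < length (A ++ B)
  t<AB = <-≤-trans t<A (length-++-≤ˡ A)

ω-swap : ∀ A B i → ω (B ++ A) i ≡ ω (A ++ B) (length A + i)
ω-swap []          B i = cong (λ W → ω W i) (++-identityʳ B)
ω-swap A@(_ ∷ _) B i = begin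
  ω (B ++ A) i                  ≡⟨ ω≡letter-% (B ++ A) (length-++-comm B A) i ⟩
  letter (B ++ A) (i % n)       ≡⟨ letter-swap A B i%n<BA ⟩
  ω (A ++ B) (length A + i % n) ≡⟨ ω-cong-% (A ++ B) refl (length A + i % n) (length A + i) A+i%n≡A+i ⟩
  ω (A ++ B) (length A + i)     ∎
  where
  open ≡-Reasoning
  n = length (A ++ B)
  i%n<BA : i % n < length (B ++ A)
  i%n<BA = subst (i % n <_) (sym (length-++-comm B A)) (m%n<n i n)
  A+i%n≡A+i : (length A + i % n) % n ≡ (length A + i) % n
  A+i%n≡A+i = [m+n%d]%d≡[m+n]%d (length A) i n

length-rot : ∀ k W → length (rot k W) ≡ length W
length-rot k W = trans (length-++-comm (drop k W) (take k W)) (cong length (take++drop≡id k W))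

ω-rot : ∀ {k W} → k ≤ length W → ω (rot k W) ≗ ω W ∘ (k +_)
ω-rot {k} {W} k≤W i = begin
  ω (drop k W ++ take k W) i                       ≡⟨ ω-swap (take k W) (drop k W) i ⟩
  ω (take k W ++ drop k W) (length (take k W) + i) ≡⟨ cong₂ (λ V m → ω V (m + i)) (take++drop≡id k W) |take|≡k ⟩
  ω W (k + i)                                      ∎
  where
  open ≡-Reasoning
  |take|≡k : length (take k W) ≡ k
  |take|≡k = trans (length-take k W) (m≤n⇒m⊓n≡m k≤W)

≺alt⇒≺ : ∀ {x xs} V → 0 < length V → (x ∷ xs) ≺alt V → ω (x ∷ xs) ≺ ω V
≺alt⇒≺ (_ ∷ _) _ x∷xs≺V = x∷xs≺V

Galois⇒≺-shift : ∀ {W k} → IsGalois W → 0 < k → k < length W → ω W ≺ ω W ∘ (k +_)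
Galois⇒≺-shift {x ∷ xs} {k} galois 0<k k<W =
  ≺-respʳ-≗ (ω-rot (<⇒≤ k<W)) (≺alt⇒≺ (rot k (x ∷ xs)) 0<rot (galois k 0<k k<W))
  where
  0<rot : 0 < length (rot k (x ∷ xs))
  0<rot = subst (0 <_) (sym (length-rot k (x ∷ xs))) (<-trans 0<k k<W)

Galois⇒period-parity : ∀ {Q p} → IsGalois Q → IsPeriod p Q → p < length Q → p % 2 ≢ length Q % 2
Galois⇒period-parity {Q} {p} galois (1≤p , _ , period) p<Q p≡Q with m≤n⇒∃[o]m+o≡n (<⇒≤ p<Q)
... | d , p+d≡Q = ≺-shift-even-period 2∣d full-period prefix-period
  (Galois⇒≺-shift galois 1≤p p<Q) (Galois⇒≺-shift galois 0<d d<Q)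
  where
  2∣d : 2 ∣ d
  2∣d = m%2≡[m+n]%2⇒2∣n p d (trans p≡Q (cong (_% 2) (sym p+d≡Q)))
  full-period : ω Q ∘ ((p + d) +_) ≗ ω Q
  full-period i = trans (cong (λ m → ω Q (m + i)) p+d≡Q) (ω-periodic Q i)
  prefix-period : ∀ k → k < d → ω Q (p + k) ≡ ω Q k
  prefix-period k k<d = trans (cong (ω Q) (+-comm p k)) (period k k+p<Q)
    where
    k+p<Q : k + p < length Q
    k+p<Q = subst₂ _<_ (+-comm p k) p+d≡Q (+-monoʳ-< p k<d)
  0<d : 0 < d
  0<d = +-cancelˡ-< p 0 d (subst₂ _<_ (sym (+-identityʳ p)) (sym p+d≡Q) p<Q)
  d<Q : d < length Q
  d<Q = subst (d <_) p+d≡Q (m<n+m d 1≤p)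

ω-++ˡ : ∀ Q U {i} → i < length Q → ω Q i ≡ ω (Q ++ U) i
ω-++ˡ Q U {i} i<Q = begin
  ω Q i            ≡⟨ ω≡letter Q i<Q ⟩
  letter Q i       ≡⟨ letter-++ˡ Q U i<Q ⟨
  letter (Q ++ U) i ≡⟨ ω≡letter (Q ++ U) (<-≤-trans i<Q (length-++-≤ˡ Q)) ⟨
  ω (Q ++ U) i     ∎
  where open ≡-Reasoning

IsPeriod-prefix : ∀ {p Q T} → IsPrefix Q T → p ≤ length Q → IsPeriod p T → IsPeriod p Q
IsPeriod-prefix {p} {Q} (U , refl) p≤Q (1≤p , _ , period) = 1≤p , p≤Q , λ i i+p<Q → begin
  ω Q (i + p)        ≡⟨ ω-++ˡ Q U i+p<Q ⟩
  ω (Q ++ U) (i + p) ≡⟨ period i (<-≤-trans i+p<Q (length-++-≤ˡ Q)) ⟩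
  ω (Q ++ U) i       ≡⟨ ω-++ˡ Q U (≤-<-trans (m≤m+n i p) i+p<Q) ⟨
  ω Q i              ∎
  where open ≡-Reasoning

++-prefix-unique : ∀ P Q {U V : Word} → length P ≡ length Q → P ++ U ≡ Q ++ V → P ≡ Q
++-prefix-unique []      []      _ _ = refl
++-prefix-unique (x ∷ P) (y ∷ Q) |P|≡|Q| eq =
  cong₂ _∷_ (∷-injectiveˡ eq) (++-prefix-unique P Q (suc-injective |P|≡|Q|) (∷-injectiveʳ eq))

GaloisRoot-length-injective : ∀ {P Q T} → IsGaloisRoot P T → IsGaloisRoot Q T →
  length P ≡ length Q → P ≡ Q
GaloisRoot-length-injective {P} {Q} ((U , PU≡T) , _) ((V , QV≡T) , _) |P|≡|Q| =
  ++-prefix-unique P Q |P|≡|Q| (trans PU≡T (sym QV≡T))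

GaloisRoot-parity-< : ∀ {P Q T} → IsGaloisRoot P T → IsGaloisRoot Q T → length P < length Q →
  length P % 2 ≢ length Q % 2
GaloisRoot-parity-< (_ , period-P , _) (prefix-Q , _ , galois-Q) |P|<|Q| =
  Galois⇒period-parity galois-Q (IsPeriod-prefix prefix-Q (<⇒≤ |P|<|Q|) period-P) |P|<|Q|

GaloisRoot-parity : ∀ {P Q T} → IsGaloisRoot P T → IsGaloisRoot Q T → P ≢ Q →
  length P % 2 ≢ length Q % 2
GaloisRoot-parity {P} {Q} root-P root-Q P≢Q with <-cmp (length P) (length Q)
... | tri< |P|<|Q| _ _ = GaloisRoot-parity-< root-P root-Q |P|<|Q|
... | tri≈ _ |P|≡|Q| _ = contradiction (GaloisRoot-length-injective root-P root-Q |P|≡|Q|) P≢Q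
... | tri> _ _ |Q|<|P| = GaloisRoot-parity-< root-Q root-P |Q|<|P| ∘ sym

_≟ʷ_ : DecidableEquality Word
_≟ʷ_ = ≡-dec _≟_

GaloisRoot-at-most-two : ∀ {P Q R T} → IsGaloisRoot P T → IsGaloisRoot Q T → IsGaloisRoot R T →
  P ≡ Q ⊎ P ≡ R ⊎ Q ≡ R
GaloisRoot-at-most-two {P} {Q} {R} root-P root-Q root-R with P ≟ʷ Q | P ≟ʷ R
... | yes P≡Q | _       = inj₁ P≡Q
... | no _    | yes P≡R = inj₂ (inj₁ P≡R)
... | no P≢Q  | no P≢R  = inj₂ (inj₂ (decidable-stable (Q ≟ʷ R) λ Q≢R →
  GaloisRoot-parity root-Q root-R Q≢R (%2-pigeonhole (length P) (length Q) (length R)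
    (GaloisRoot-parity root-P root-Q P≢Q) (GaloisRoot-parity root-P root-R P≢R))))

lemma14 : (T : Word) → IsPreGalois T →
    ((P Q R : Word) → IsGaloisRoot P T → IsGaloisRoot Q T → IsGaloisRoot R T →
      P ≡ Q ⊎ P ≡ R ⊎ Q ≡ R)
    × ((P Q : Word) → IsGaloisRoot P T → IsGaloisRoot Q T → P ≢ Q →
      length P % 2 ≢ length Q % 2)
lemma14 T _ = (λ _ _ _ → GaloisRoot-at-most-two) , (λ _ _ → GaloisRoot-parity)
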